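{- Let $\vdash$ be a finitary logic satisfying the standing assumption below, and suppose $\vdash$ has no antitheorems. Let $\bullet'$ be any finite (possibly empty) sequence of elements of $\{l,r\}$. If $\Gamma\vdash^{rl\bullet'}\varphi$ (for $\Gamma\cup\{\varphi\}\subseteq Fm$), then there exists $\Delta\subseteq\Gamma$ such that $\Delta\vdash\varphi$ and $\mathrm{Var}(\Delta)=\mathrm{Var}(\varphi)$.
   Context: Fix an algebraic language and let $Fm$ be the set of formulas built over a countably infinite set $\mathrm{Var}$ of variables. For a formula $\varphi$, $\mathrm{Var}(\varphi)$ is the set of variables occurring in $\varphi$, and for $\Gamma\subseteq Fm$, $\mathrm{Var}(\Gamma)=\bigcup_{\gamma\in\Gamma}\mathrm{Var}(\gamma)$. A logic is a consequence relation $\vdash\subseteq\mathcal{P}(Fm)\times Fm$ invariant under substitutions ($\Gamma\vdash\varphi$ implies $\sigma[\Gamma]\vdash\sigma(\varphi)$); it is finitary if $\Gamma\vdash\varphi$ iff $\Delta\vdash\varphi$ for some finite $\Delta\subseteq\Gamma$. A set $\Sigma$ of formulas is an antitheorem of $\vdash$ if $\sigma[\Sigma]\vdash\varphi$ for every substitution $\sigma$ and every formula $\varphi$. For a logic $\vdash$: the left variable inclusion companion is defined by $\Gamma\vdash^{l}\varphi$ iff there is $\Delta\subseteq\Gamma$ with $\mathrm{Var}(\Delta)\subseteq\mathrm{Var}(\varphi)$ and $\Delta\vdash\varphi$; the right variable inclusion companion is defined by $\Gamma\vdash^{r}\varphi$ iff either ($\Gamma\vdash\varphi$ and $\mathrm{Var}(\varphi)\subseteq\mathrm{Var}(\Gamma)$)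 or $\Sigma\subseteq\Gamma$ for some antitheorem $\Sigma$ of $\vdash$. For a finite sequence $u_1\dots u_n$ over $\{l,r\}$, $\vdash^{u_1\dots u_n}$ is defined recursively as the result of applying the operation $u_n$ to the logic $\vdash^{u_1\dots u_{n-1}}$ (the empty sequence gives $\vdash$ itself); juxtaposition denotes concatenation of sequences. Standing assumption: $\vdash$ is finitary and there is a binary formula $\pi(x,y)$, in which $x$ and $y$ really occur, that is an $l$-partition function for $\vdash^l$ and an $r$-partition function for $\vdash^r$. Here: for a logic $\vdash'$, $\mathrm{Alg}(\vdash')$ is the class of algebraic reducts of the reduced matrix models of $\vdash'$; a binary operation $\cdot$ on an algebra $\mathbf{A}$ is a partition function if for all $a,b,c$ and every basic operation $g$ of arity $n\ge1$: $a\cdot a=a$; $a\cdot(b\cdot c)=(a\cdot b)\cdot c$; $a\cdot(b\cdot c)=a\cdot(c\cdot b)$; $g(a_1,\dots,a_n)\cdot b=g(a_1\cdot b,\dots,a_n\cdot b)$; $b\cdot g(a_1,\dots,a_n)=b\cdot a_1\cdot\ldots\cdot a_n$. A formula $x\cdot y$ (with $x,y$ really occurring) is an $l$-partition function for $\vdash'$ if $x\vdash' x\cdot y$ and the five conditions above hold as equations in every algebra of $\mathrm{Alg}(\vdash')$; a formula $x\ast y$ (with $x,y$ really occurring) is an $r$-partition function for $\vdash'$ if $x,y\vdash' x\ast y$, $x\ast y\vdash' x$, and the term operation $\ast$ is a partition function in every algebra of $\mathrm{Alg}(\vdash')$. -}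

module Defs where

open import Data.Nat using (ℕ; zero; suc; _≤_)
open import Data.Fin using (Fin)
import Data.Fin as Fin
open import Data.List using (List; []; _∷_; foldl)
open import Data.List.Membership.Propositional using (_∈_)
open import Data.Product using (Σ; _×_; _,_)
open import Data.Sum using (_⊎_)
open import Relation.Nullary using (¬_)
open import Relation.Binary.PropositionalEquality using (_≡_)

record Lang : Set₁ where
  field
    Op : Set
    ar : Op → ℕ
open Lang public

data Fm (L : Lang) : Set where
  var : ℕ → Fm L
  app : (o : Op L) → (Fin (ar L o) → Fm L) → Fm L

module _ {L : Lang} where

  FmSet : Set₁
  FmSet = Fm L → Set

  _⊆_ : FmSet → FmSet → Set
  Δ ⊆ Γ = ∀ ψ → Δ ψ → Γ ψ

  data Occ (x : ℕ) : Fm L → Set where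
    here  : Occ x (var x)
    there : ∀ {o args} (i : Fin (ar L o)) → Occ x (args i) → Occ x (app o args)

  VarOf : FmSet → ℕ → Set
  VarOf Γ x = Σ (Fm L) λ γ → Γ γ × Occ x γ

  Subst : Set
  Subst = ℕ → Fm L

  sub : Subst → Fm L → Fm L
  sub σ (var x) = σ x
  sub σ (app o args) = app o (λ i → sub σ (args i))

  subImg : Subst → FmSet → FmSet
  subImg σ Γ ψ = Σ (Fm L) λ γ → Γ γ × ψ ≡ sub σ γ

  Cons : Set₂
  Cons = FmSet → Fm L → Set₁

  record IsLogic (_⊢_ : Cons) : Set₂ where
    field
      reflexive  : ∀ Γ φ → Γ φ → Γ ⊢ φ
      monotone   : ∀ Γ Δ φ → Γ ⊆ Δ → Γ ⊢ φ → Δ ⊢ φ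
      cut        : ∀ Γ Δ φ → (∀ ψ → Δ ψ → Γ ⊢ ψ) → Δ ⊢ φ → Γ ⊢ φ
      structural : ∀ Γ φ (σ : Subst) → Γ ⊢ φ → subImg σ Γ ⊢ sub σ φ

  listSet : List (Fm L) → FmSet
  listSet xs ψ = ψ ∈ xs

  Finitary : Cons → Set₁
  Finitary _⊢_ = ∀ Γ φ → (Γ ⊢ φ → Σ (List (Fm L)) λ xs → (listSet xs ⊆ Γ) × (listSet xs ⊢ φ))
                       × ((Σ (List (Fm L)) λ xs → (listSet xs ⊆ Γ) × (listSet xs ⊢ φ)) → Γ ⊢ φ)

  Antitheorem : Cons → FmSet → Set₁
  Antitheorem _⊢_ S = ∀ (σ : Subst) (φ : Fm L) → subImg σ S ⊢ φ

  NoAntitheorems : Cons → Set₁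
  NoAntitheorems _⊢_ = ∀ S → ¬ Antitheorem _⊢_ S

  leftComp : Cons → Cons
  leftComp _⊢_ Γ φ = Σ FmSet λ Δ → (Δ ⊆ Γ) × (∀ x → VarOf Δ x → Occ x φ) × (Δ ⊢ φ)

  rightComp : Cons → Cons
  rightComp _⊢_ Γ φ = (Γ ⊢ φ × (∀ x → Occ x φ → VarOf Γ x))
                    ⊎ (Σ FmSet λ S → Antitheorem _⊢_ S × (S ⊆ Γ))

  data LR : Set where
    l r : LR

  applyLR : LR → Cons → Cons
  applyLR l = leftComp
  applyLR r = rightComp

  -- ⊢^{u₁…uₙ}: apply u₁ first, …, uₙ last
  companion : Cons → List LR → Cons
  companion ⊢ us = foldl (λ ⊢' u → applyLR u ⊢') ⊢ us

  record Algebra : Set₁ where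
    field
      Carrier : Set
      op : (o : Op L) → (Fin (ar L o) → Carrier) → Carrier

  module _ (A : Algebra) where
    open Algebra A

    eval : (ℕ → Carrier) → Fm L → Carrier
    eval h (var x) = h x
    eval h (app o args) = op o (λ i → eval h (args i))

    IsModel : Cons → (Carrier → Set) → Set₁
    IsModel _⊢_ F = ∀ Γ φ → Γ ⊢ φ → (h : ℕ → Carrier)
                    → (∀ γ → Γ γ → F (eval h γ)) → F (eval h φ)

    record IsCongruence (θ : Carrier → Carrier → Set) : Set where
      field
        refl′  : ∀ a → θ a a
        sym′   : ∀ a b → θ a b → θ b a
        trans′ : ∀ a b c → θ a b → θ b c → θ a c
        compat : ∀ o (as bs : Fin (ar L o) → Carrier) → (∀ i → θ (as i) (bs i)) → θ (op o as) (op o bs)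

    CompatibleWith : (Carrier → Carrier → Set) → (Carrier → Set) → Set
    CompatibleWith θ F = ∀ a b → θ a b → F a → F b

    -- reduced: the Leibniz congruence of F is the identity, i.e. the only
    -- congruence compatible with F is the identity relation
    Reduced : (Carrier → Set) → Set₁
    Reduced F = ∀ θ → IsCongruence θ → CompatibleWith θ F → ∀ a b → θ a b → a ≡ b

    -- binary term operation induced by a formula in variables x = 0, y = 1
    val2 : Carrier → Carrier → ℕ → Carrier
    val2 a b zero = a
    val2 a b (suc zero) = b
    val2 a b (suc (suc _)) = a

    termOp : Fm L → Carrier → Carrier → Carrier
    termOp π a b = eval (val2 a b) π

    foldlFin : (Carrier → Carrier → Carrier) → Carrier → ∀ {n} → (Fin n → Carrier) → Carrier
    foldlFin _·_ b {zero} as = b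
    foldlFin _·_ b {suc n} as = foldlFin _·_ (b · as Fin.zero) (λ i → as (Fin.suc i))

    IsPartitionFunction : (Carrier → Carrier → Carrier) → Set
    IsPartitionFunction _·_ =
        (∀ a → (a · a) ≡ a)
      × (∀ a b c → (a · (b · c)) ≡ ((a · b) · c))
      × (∀ a b c → (a · (b · c)) ≡ (a · (c · b)))
      × (∀ g (as : Fin (ar L g) → Carrier) b → 1 ≤ ar L g
           → (op g as · b) ≡ op g (λ i → as i · b))
      × (∀ g (as : Fin (ar L g) → Carrier) b → 1 ≤ ar L g
           → (b · op g as) ≡ foldlFin _·_ b as)

  InAlg : Cons → Algebra → Set₁
  InAlg ⊢ A = Σ (Algebra.Carrier A → Set) λ F → IsModel A ⊢ F × Reduced A F

  x₀ y₀ : Fm L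
  x₀ = var 0
  y₀ = var 1

  ReallyBinary : Fm L → Set
  ReallyBinary π = ∀ n → (Occ n π → n ≡ 0 ⊎ n ≡ 1) × (n ≡ 0 ⊎ n ≡ 1 → Occ n π)

  IsLPartition : Cons → Fm L → Set₁
  IsLPartition ⊢ π = ReallyBinary π
    × ⊢ (λ ψ → ψ ≡ x₀) π
    × (∀ A → InAlg ⊢ A → IsPartitionFunction A (termOp A π))

  IsRPartition : Cons → Fm L → Set₁
  IsRPartition ⊢ π = ReallyBinary π
    × ⊢ (λ ψ → ψ ≡ x₀ ⊎ ψ ≡ y₀) π
    × ⊢ (λ ψ → ψ ≡ π) x₀
    × (∀ A → InAlg ⊢ A → IsPartitionFunction A (termOp A π))

  StandingAssumption : Cons → Set₁
  StandingAssumption ⊢ = Σ (Fm L) λ π → IsLPartition (leftComp ⊢) π × IsRPartition (rightComp ⊢) π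

-- Without antitheorems the antitheorem clause of the right companion never
-- fires, so Γ ⊢^{rl} φ yields Δ ⊆ Γ with Δ ⊢ φ, Var(Δ) ⊆ Var(φ) (left step) and
-- Var(φ) ⊆ Var(Δ) (right step). This property of a consequence relation is
-- inherited by both companions: the left one only shrinks the premises, and
-- the right one cannot acquire antitheorems from a relation contained in ⊢.
module Submission where

open import Defs
open import Data.List using (List; []; _∷_)
open import Data.Product using (Σ; _×_; _,_)
open import Data.Sum using (inj₁; inj₂)
open import Data.Empty using (⊥-elim)

module _ {L : Lang} where

  ExactPremises : Cons {L} → FmSet {L} → Fm L → Set₁
  ExactPremises ⊢ Γ φ = Σ (FmSet {L}) λ Δ → (Δ ⊆ Γ) × ⊢ Δ φ
    × (∀ x → VarOf Δ x → Occ x φ) × (∀ x → Occ x φ → VarOf Δ x)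

  HasExactPremises : Cons {L} → Cons {L} → Set₁
  HasExactPremises ⊢ ⊢′ = ∀ Γ φ → ⊢′ Γ φ → ExactPremises ⊢ Γ φ

  exactPremises-mono : ∀ {⊢ Γ Γ′ φ} → Γ ⊆ Γ′ → ExactPremises ⊢ Γ φ → ExactPremises ⊢ Γ′ φ
  exactPremises-mono Γ⊆Γ′ (Δ , Δ⊆Γ , rest) = Δ , (λ ψ ψ∈Δ → Γ⊆Γ′ ψ (Δ⊆Γ ψ ψ∈Δ)) , rest

  hasExactPremises⇒⊆ : ∀ {⊢ ⊢′} → IsLogic ⊢ → HasExactPremises ⊢ ⊢′ → ∀ Γ φ → ⊢′ Γ φ → ⊢ Γ φ
  hasExactPremises⇒⊆ logic exact Γ φ Γ⊢′φ with exact Γ φ Γ⊢′φ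
  ... | Δ , Δ⊆Γ , Δ⊢φ , _ = IsLogic.monotone logic Δ Γ φ Δ⊆Γ Δ⊢φ

  noAntitheorems-antitone : (⊢ ⊢′ : Cons {L}) → (∀ Γ φ → ⊢′ Γ φ → ⊢ Γ φ)
    → NoAntitheorems ⊢ → NoAntitheorems ⊢′
  noAntitheorems-antitone ⊢ ⊢′ ⊢′⊆⊢ noAnti S anti = noAnti S λ σ φ → ⊢′⊆⊢ _ φ (anti σ φ)

  leftComp-hasExactPremises : ∀ {⊢ ⊢′} → HasExactPremises ⊢ ⊢′
    → HasExactPremises ⊢ (leftComp ⊢′)
  leftComp-hasExactPremises {⊢} exact Γ φ (Δ , Δ⊆Γ , _ , Δ⊢′φ) =
    exactPremises-mono {⊢} Δ⊆Γ (exact Δ φ Δ⊢′φ)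

  rightComp-hasExactPremises : ∀ {⊢ ⊢′} → IsLogic ⊢ → NoAntitheorems ⊢
    → HasExactPremises ⊢ ⊢′ → HasExactPremises ⊢ (rightComp ⊢′)
  rightComp-hasExactPremises _ _ exact Γ φ (inj₁ (Γ⊢′φ , _)) = exact Γ φ Γ⊢′φ
  rightComp-hasExactPremises {⊢} {⊢′} logic noAnti exact Γ φ (inj₂ (S , anti , _)) =
    ⊥-elim (noAntitheorems-antitone ⊢ ⊢′ (hasExactPremises⇒⊆ logic exact) noAnti S anti)

  companion-hasExactPremises : ∀ {⊢} → IsLogic ⊢ → NoAntitheorems ⊢ → (us : List LR) {⊢′ : Cons {L}}
    → HasExactPremises ⊢ ⊢′ → HasExactPremises ⊢ (companion ⊢′ us)
  companion-hasExactPremises _ _ [] exact = exact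
  companion-hasExactPremises logic noAnti (l ∷ us) exact =
    companion-hasExactPremises logic noAnti us (leftComp-hasExactPremises exact)
  companion-hasExactPremises logic noAnti (r ∷ us) exact =
    companion-hasExactPremises logic noAnti us (rightComp-hasExactPremises logic noAnti exact)

  rightLeftComp-hasExactPremises : ∀ {⊢} → NoAntitheorems ⊢
    → HasExactPremises ⊢ (leftComp (rightComp ⊢))
  rightLeftComp-hasExactPremises _ Γ φ (Δ , Δ⊆Γ , VarΔ⊆Varφ , inj₁ (Δ⊢φ , Varφ⊆VarΔ)) =
    Δ , Δ⊆Γ , Δ⊢φ , VarΔ⊆Varφ , Varφ⊆VarΔ
  rightLeftComp-hasExactPremises noAnti Γ φ (_ , _ , _ , inj₂ (S , anti , _)) = ⊥-elim (noAnti S anti)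

lemma4p1 : (L : Lang) (⊢ : Cons {L}) → IsLogic ⊢ → Finitary ⊢ → StandingAssumption ⊢
    → NoAntitheorems ⊢ → (bullet′ : List LR) (Γ : FmSet {L}) (φ : Fm L)
    → companion ⊢ (r ∷ l ∷ bullet′) Γ φ
    → Σ (FmSet {L}) λ Δ → (Δ ⊆ Γ) × ⊢ Δ φ
        × (∀ x → VarOf Δ x → Occ x φ) × (∀ x → Occ x φ → VarOf Δ x)
lemma4p1 L ⊢ logic _ _ noAnti bullet′ =
  companion-hasExactPremises logic noAnti bullet′ (rightLeftComp-hasExactPremises noAnti)
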